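{- Let $G$ be a tree, let $T$ be an EPT of $G$, let $uv\in E(G)$, and let $G_u,G_v$ be the components of $G\setminus uv$ containing $u$ and $v$ respectively. Let $T^u,T^v$ be the splitting of $T$ along $uv$ (as defined in the context). Then $\mathrm{EPTsum}(G_u,T^u)+\mathrm{EPTsum}(G_v,T^v)<\mathrm{EPTsum}(G,T)$.
   Context: An edge partition tree (EPT) of a tree $G$ is a rooted full binary tree defined inductively: if $G$ has a single vertex, its EPT is a single node (a leaf identified with that vertex); otherwise the root corresponds to an edge $e\in E(G)$ and its two children are roots of EPTs of the two components of $G\setminus e$. Leaves of the EPT are identified with vertices of $G$ and internal nodes with edges of $G$. The depth of a node is its distance from the root. For an EPT $T$ of $G$, $\mathrm{EPTsum}(G,T)$ is the sum over all vertices of $G$ of the depth of the corresponding leaf in $T$. The splitting of $T$ along the edge $uv$ is the pair of rooted trees $T^u,T^v$ defined as follows: the node set of $T^u$ consists of the nodes of $T$ (leaves and internal nodes) corresponding to vertices and edges of $G_u$, and for any such node $x$, its parent in $T^u$ is the lowest proper ancestor of $x$ in $T$ whose corresponding edge lies in $G_u$; if there is no such ancestor, $x$ is the root of $T^u$. $T^v$ is defined analogously with $G_v$. (These $T^u,T^v$ are EPTs of $G_u,G_v$.) -}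

module Defs where

open import Data.Nat using (ℕ; zero; suc; _+_)
open import Data.Unit using (⊤)
open import Data.Fin using (Fin)
open import Data.Product using (_×_; _,_; proj₁; proj₂)
open import Data.Sum using (_⊎_; inj₁; inj₂)
open import Data.List using (List; []; _∷_; _++_)
open import Relation.Nullary using (¬_)
open import Relation.Binary.PropositionalEquality using (_≡_; _≢_)

-- A (multi)graph on vertex set Fin n with m edges is given by
-- an endpoint map  ends : Fin m → Fin n × Fin n  (edges are unordered;
-- the order of the pair is irrelevant everywhere below).

record Sub (n m : ℕ) : Set₁ where
  constructor sub
  field
    V : Fin n → Set
    E : Fin m → Set
open Sub public

module _ {n m : ℕ} (ends : Fin m → Fin n × Fin n) where

  Joins : Fin m → Fin n → Fin n → Set
  Joins f x z = (ends f ≡ (x , z)) ⊎ (ends f ≡ (z , x))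

  Full : Sub n m
  Full = sub (λ _ → ⊤) (λ _ → ⊤)

  _─_ : Sub n m → Fin m → Sub n m
  H ─ e = sub (V H) (λ f → E H f × f ≢ e)

  data Reach (H : Sub n m) : Fin n → Fin n → Set where
    here : ∀ {x} → V H x → Reach H x x
    step : ∀ {x z y} (f : Fin m) → V H x → E H f → Joins f x z →
           Reach H z y → Reach H x y

  Comp : Sub n m → Fin n → Sub n m
  Comp H x = sub (λ y → V H y × Reach H x y)
                 (λ f → E H f × Reach H x (proj₁ (ends f))
                              × Reach H x (proj₂ (ends f)))

  IsTree : Sub n m → Set
  IsTree H = (∀ x y → V H x → V H y → Reach H x y)
           × (∀ f → E H f → ¬ Reach (H ─ f) (proj₁ (ends f)) (proj₂ (ends f)))

data EPT (n m : ℕ) : Set where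
  leaf : Fin n → EPT n m
  node : Fin m → EPT n m → EPT n m → EPT n m

module _ {n m : ℕ} (ends : Fin m → Fin n × Fin n) where

  -- IsEPT H T : T is an EPT of the (tree) subgraph H, defined inductively
  -- as in the paper; the two children are EPTs of the two components of
  -- H ∖ e (in either order).
  data IsEPT : Sub n m → EPT n m → Set₁ where
    leafEPT : ∀ {H x} → V H x → (∀ y → V H y → y ≡ x) →
              (∀ f → ¬ E H f) → IsEPT H (leaf x)
    nodeEPT : ∀ {H e a b l r} → E H e → ends e ≡ (a , b) →
              IsEPT (Comp ends (_─_ ends H e) a) l →
              IsEPT (Comp ends (_─_ ends H e) b) r →
              IsEPT H (node e l r)
    nodeEPT' : ∀ {H e a b l r} → E H e → ends e ≡ (a , b) →
              IsEPT (Comp ends (_─_ ends H e) b) l →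
              IsEPT (Comp ends (_─_ ends H e) a) r →
              IsEPT H (node e l r)

depthSum : ∀ {n m} → ℕ → EPT n m → ℕ
depthSum d (leaf x) = d
depthSum d (node e l r) = depthSum (suc d) l + depthSum (suc d) r

EPTsum : ∀ {n m} → EPT n m → ℕ
EPTsum T = depthSum 0 T

-- Restricting T to the nodes corresponding to vertices and
-- edges of a subgraph H, where the parent of a kept node is its lowest
-- proper kept ancestor, yields a rooted forest (a list of rose trees);
-- for H = G_u it is a single tree T^u.

data RTree (n m : ℕ) : Set where
  rnode : Fin n ⊎ Fin m → List (RTree n m) → RTree n m

module _ {n m : ℕ} (ends : Fin m → Fin n × Fin n) where

  data Restrict (H : Sub n m) : EPT n m → List (RTree n m) → Set where
    leafIn  : ∀ {x} → V H x → Restrict H (leaf x) (rnode (inj₁ x) [] ∷ [])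
    leafOut : ∀ {x} → ¬ V H x → Restrict H (leaf x) []
    nodeIn  : ∀ {e l r Fl Fr} → E H e → Restrict H l Fl → Restrict H r Fr →
              Restrict H (node e l r) (rnode (inj₂ e) (Fl ++ Fr) ∷ [])
    nodeOut : ∀ {e l r Fl Fr} → ¬ E H e → Restrict H l Fl → Restrict H r Fr →
              Restrict H (node e l r) (Fl ++ Fr)

mutual
  rSum : ∀ {n m} → ℕ → RTree n m → ℕ
  rSum d (rnode (inj₁ x) cs) = d + fSum (suc d) cs
  rSum d (rnode (inj₂ e) cs) = fSum (suc d) cs

  fSum : ∀ {n m} → ℕ → List (RTree n m) → ℕ
  fSum d [] = 0
  fSum d (t ∷ ts) = rSum d t + fSum d ts

EPTsumF : ∀ {n m} → List (RTree n m) → ℕ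
EPTsumF F = fSum 0 F

{-# OPTIONS --safe #-}
module Submission where

open import Defs
open import Data.Nat using (ℕ; suc; _+_; _≤_; _<_; z≤n; s≤s)
open import Data.Nat.Properties
  using (≤-refl; ≤-trans; m≤n⇒m≤1+n; m≤n+m; +-suc; +-mono-≤; +-monoʳ-≤; +-identityʳ; +-assoc;
         +-commutativeSemigroup; module ≤-Reasoning)
open import Data.Fin using (Fin; _≟_)
open import Data.Product using (_×_; _,_; proj₁; proj₂)
open import Data.Sum using (_⊎_; inj₁; inj₂)
open import Data.List using (List; []; _∷_; _++_)
open import Data.Unit using (tt)
open import Data.Empty using (⊥; ⊥-elim)
open import Relation.Nullary using (¬_; yes; no)
open import Relation.Binary.PropositionalEquality
  using (_≡_; refl; sym; trans; cong; subst; module ≡-Reasoning)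
open import Algebra.Properties.CommutativeSemigroup +-commutativeSemigroup using (interchange)

-- Restricting T to G_u (or G_v) never increases the depth of a
-- leaf: an ancestor is either kept or dropped.  G_u and G_v have no common
-- vertex, so the two restricted sums together count every leaf of T at most
-- once, each at depth at most its depth in T.  The edge uv lies in neither
-- G_u nor G_v but, being an edge of G, labels a node of T; every leaf below
-- that node (there is at least one) loses one unit of depth.

module _ {n m : ℕ} (ends : Fin m → Fin n × Fin n) where

  private
    _-_ : Sub n m → Fin m → Sub n m
    H - e = _─_ ends H e

  reach-source : ∀ {H x y} → Reach ends H x y → V H x
  reach-source (here vx) = vx
  reach-source (step _ vx _ _ _) = vx

  reach-target : ∀ {H x y} → Reach ends H x y → V H y
  reach-target (here vy) = vy
  reach-target (step _ _ _ _ w) = reach-target w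

  reach-trans : ∀ {H x y z} → Reach ends H x y → Reach ends H y z → Reach ends H x z
  reach-trans (here _) w′ = w′
  reach-trans (step f vx ef j w) w′ = step f vx ef j (reach-trans w w′)

  joins-sym : ∀ {f x z} → Joins ends f x z → Joins ends f z x
  joins-sym (inj₁ eq) = inj₂ eq
  joins-sym (inj₂ eq) = inj₁ eq

  reach-sym : ∀ {H x y} → Reach ends H x y → Reach ends H y x
  reach-sym (here vx) = here vx
  reach-sym (step f vx ef j w) =
    reach-trans (reach-sym w) (step f (reach-source w) ef (joins-sym j) (here vx))

  joins-ends : ∀ {f x z} (P : Fin n → Set) → Joins ends f x z → P x → P z →
               P (proj₁ (ends f)) × P (proj₂ (ends f))
  joins-ends P (inj₁ eq) px pz rewrite eq = px , pz
  joins-ends P (inj₂ eq) px pz rewrite eq = pz , px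

  reach-comp : ∀ {H a x y} → Reach ends H a x → Reach ends H x y → Reach ends (Comp ends H a) x y
  reach-comp wax (here vx) = here (vx , wax)
  reach-comp {H} {a} wax (step f vx ef j w) =
    step f (vx , wax) (ef , joins-ends (Reach ends H a) j wax waz) j (reach-comp waz w)
    where
    waz : Reach ends H a _
    waz = reach-trans wax (step f vx ef j (here (reach-source w)))

  Connected : Sub n m → Set
  Connected H = ∀ x y → V H x → V H y → Reach ends H x y

  IsSubgraph : Sub n m → Set
  IsSubgraph H = ∀ f → E H f → V H (proj₁ (ends f)) × V H (proj₂ (ends f))

  comp-connected : ∀ {H a} → Connected (Comp ends H a)
  comp-connected x y (_ , wax) (_ , way) = reach-comp wax (reach-trans (reach-sym wax) way)

  comp-subgraph : ∀ {H a} → IsSubgraph (Comp ends H a)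
  comp-subgraph f (_ , w₁ , w₂) = (reach-target w₁ , w₁) , (reach-target w₂ , w₂)

  reach-after-last-crossing : ∀ {H e a b x y} → ends e ≡ (a , b) → Reach ends H x y →
    Reach ends (H - e) x y ⊎ (Reach ends (H - e) a y ⊎ Reach ends (H - e) b y)
  reach-after-last-crossing eq (here vx) = inj₁ (here vx)
  reach-after-last-crossing {e = e} eq (step f vx ef j w) with f ≟ e | reach-after-last-crossing eq w
  ... | _      | inj₂ w′ = inj₂ w′
  ... | no f≢e | inj₁ w′ = inj₁ (step f vx (ef , f≢e) j w′)
  reach-after-last-crossing eq (step f vx ef (inj₁ eq′) w) | yes refl | inj₁ w′
    rewrite sym (cong proj₂ (trans (sym eq) eq′)) = inj₂ (inj₂ w′)
  reach-after-last-crossing eq (step f vx ef (inj₂ eq′) w) | yes refl | inj₁ w′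
    rewrite sym (cong proj₁ (trans (sym eq) eq′)) = inj₂ (inj₁ w′)

  edge-in-comp-of-reach : ∀ {H e c f} → IsSubgraph H → E H f → ¬ f ≡ e →
    Reach ends (H - e) c (proj₁ (ends f)) → E (Comp ends (H - e) c) f
  edge-in-comp-of-reach {f = f} subgraph ef f≢e w =
    (ef , f≢e) , w ,
    reach-trans w (step f (proj₁ (subgraph f ef)) (ef , f≢e) (inj₁ refl) (here (proj₂ (subgraph f ef))))

  edge-in-comp : ∀ {H e a b f} → Connected H → IsSubgraph H → E H e → ends e ≡ (a , b) →
    E H f → ¬ f ≡ e → E (Comp ends (H - e) a) f ⊎ E (Comp ends (H - e) b) f
  edge-in-comp {H} {e} {a} {b} {f} connected subgraph ee eq ef f≢e
    with reach-after-last-crossing eq (connected a (proj₁ (ends f)) va (proj₁ (subgraph f ef)))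
    where
    va : V H a
    va = subst (λ p → V H (proj₁ p)) eq (proj₁ (subgraph e ee))
  ... | inj₁ w        = inj₁ (edge-in-comp-of-reach subgraph ef f≢e w)
  ... | inj₂ (inj₁ w) = inj₁ (edge-in-comp-of-reach subgraph ef f≢e w)
  ... | inj₂ (inj₂ w) = inj₂ (edge-in-comp-of-reach subgraph ef f≢e w)

  VertexDisjoint : Sub n m → Sub n m → Set
  VertexDisjoint H₁ H₂ = ∀ {x} → V H₁ x → V H₂ x → ⊥

  bridge-separates : ∀ {H e u v} →
    (∀ f → E H f → ¬ Reach ends (H - f) (proj₁ (ends f)) (proj₂ (ends f))) →
    E H e → Joins ends e u v → ¬ Reach ends (H - e) u v
  bridge-separates {H} {e} acyclic ee (inj₁ eq) w =
    acyclic e ee (subst (λ p → Reach ends (H - e) (proj₁ p) (proj₂ p)) (sym eq) w)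
  bridge-separates {H} {e} acyclic ee (inj₂ eq) w =
    acyclic e ee (subst (λ p → Reach ends (H - e) (proj₁ p) (proj₂ p)) (sym eq) (reach-sym w))

  removed-edge-∉-comp : ∀ {H e a} → ¬ E (Comp ends (H - e) a) e
  removed-edge-∉-comp ((_ , e≢e) , _) = e≢e refl

  comps-disjoint : ∀ {H u v} → ¬ Reach ends H u v → VertexDisjoint (Comp ends H u) (Comp ends H v)
  comps-disjoint u↛v (_ , wux) (_ , wvx) = u↛v (reach-trans wux (reach-sym wvx))

data Occurs {n m : ℕ} (e : Fin m) : EPT n m → Set where
  here  : ∀ {l r} → Occurs e (node e l r)
  left  : ∀ {f l r} → Occurs e l → Occurs e (node f l r)
  right : ∀ {f l r} → Occurs e r → Occurs e (node f l r)

fSum-++ : ∀ {n m} d (xs ys : List (RTree n m)) → fSum d (xs ++ ys) ≡ fSum d xs + fSum d ys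
fSum-++ d [] ys = refl
fSum-++ d (t ∷ xs) ys = begin
  rSum d t + fSum d (xs ++ ys)        ≡⟨ cong (rSum d t +_) (fSum-++ d xs ys) ⟩
  rSum d t + (fSum d xs + fSum d ys)  ≡⟨ sym (+-assoc (rSum d t) (fSum d xs) (fSum d ys)) ⟩
  rSum d t + fSum d xs + fSum d ys    ∎
  where open ≡-Reasoning

fSum-leaf : ∀ {n m} d (x : Fin n) → fSum {n} {m} d (rnode (inj₁ x) [] ∷ []) ≡ d
fSum-leaf d x = trans (+-identityʳ _) (+-identityʳ d)

interchange-≤ : ∀ a b c e {p q kˡ kʳ x y} → p ≡ a + b → q ≡ c + e →
                kˡ + (a + c) ≤ x → kʳ + (b + e) ≤ y → kˡ + kʳ + (p + q) ≤ x + y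
interchange-≤ a b c e {kˡ = kˡ} {kʳ} {x} {y} refl refl hˡ hʳ =
  subst (_≤ x + y) (sym regroup) (+-mono-≤ hˡ hʳ)
  where
  open ≡-Reasoning
  regroup : kˡ + kʳ + (a + b + (c + e)) ≡ kˡ + (a + c) + (kʳ + (b + e))
  regroup = begin
    kˡ + kʳ + (a + b + (c + e))  ≡⟨ cong (kˡ + kʳ +_) (interchange a b c e) ⟩
    kˡ + kʳ + (a + c + (b + e))  ≡⟨ interchange kˡ kʳ (a + c) (b + e) ⟩
    kˡ + (a + c) + (kʳ + (b + e)) ∎

child-slack : ∀ {k d d₁ d′} → d′ ≤ suc d₁ → k + d₁ ≤ d → k + d′ ≤ suc d
child-slack {k} {d} {d₁} {d′} h p = begin
  k + d′      ≤⟨ +-monoʳ-≤ k h ⟩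
  k + suc d₁  ≡⟨ +-suc k d₁ ⟩
  suc (k + d₁) ≤⟨ s≤s p ⟩
  suc d       ∎
  where open ≤-Reasoning

module _ {n m : ℕ} (ends : Fin m → Fin n × Fin n) where

  ept-edge-occurs : ∀ {H T f} → IsEPT ends H T → Connected ends H → IsSubgraph ends H →
                    E H f → Occurs f T
  ept-edge-occurs {f = f} (leafEPT _ _ no-edge) _ _ ef = ⊥-elim (no-edge f ef)
  ept-edge-occurs {f = f} (nodeEPT {e = e} ee eq tl tr) connected subgraph ef with f ≟ e
  ... | yes refl = here
  ... | no f≢e with edge-in-comp ends connected subgraph ee eq ef f≢e
  ...   | inj₁ efl = left (ept-edge-occurs tl (comp-connected ends) (comp-subgraph ends) efl)
  ...   | inj₂ efr = right (ept-edge-occurs tr (comp-connected ends) (comp-subgraph ends) efr)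
  ept-edge-occurs {f = f} (nodeEPT' {e = e} ee eq tl tr) connected subgraph ef with f ≟ e
  ... | yes refl = here
  ... | no f≢e with edge-in-comp ends connected subgraph ee eq ef f≢e
  ...   | inj₁ efr = right (ept-edge-occurs tr (comp-connected ends) (comp-subgraph ends) efr)
  ...   | inj₂ efl = left (ept-edge-occurs tl (comp-connected ends) (comp-subgraph ends) efl)

  -- depth: where the restrictions of the two children are rooted.
  record NodeRestriction (H : Sub n m) (e : Fin m) (l r : EPT n m) (d : ℕ) (F : List (RTree n m)) : Set where
    field
      depth         : ℕ
      depth≤        : depth ≤ suc d
      depth-dropped : ¬ E H e → depth ≡ d
      forestˡ       : List (RTree n m)
      forestʳ       : List (RTree n m)
      restrictˡ     : Restrict ends H l forestˡ
      restrictʳ     : Restrict ends H r forestʳ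
      fSum-children : fSum d F ≡ fSum depth forestˡ + fSum depth forestʳ

  open NodeRestriction

  restrict-node : ∀ {H e l r F} d → Restrict ends H (node e l r) F → NodeRestriction H e l r d F
  restrict-node d (nodeIn {Fl = Fl} {Fr} ee rl rr) = record
    { depth = suc d ; depth≤ = ≤-refl ; depth-dropped = λ e∉H → ⊥-elim (e∉H ee)
    ; forestˡ = Fl ; forestʳ = Fr ; restrictˡ = rl ; restrictʳ = rr
    ; fSum-children = trans (+-identityʳ _) (fSum-++ (suc d) Fl Fr) }
  restrict-node d (nodeOut {Fl = Fl} {Fr} _ rl rr) = record
    { depth = d ; depth≤ = m≤n⇒m≤1+n ≤-refl ; depth-dropped = λ _ → refl
    ; forestˡ = Fl ; forestʳ = Fr ; restrictˡ = rl ; restrictʳ = rr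
    ; fSum-children = fSum-++ d Fl Fr }

  dropped-child-slack : ∀ {H e l r d₁ F d} (s : NodeRestriction H e l r d₁ F) → ¬ E H e →
                        d₁ ≤ d → 1 + depth s ≤ suc d
  dropped-child-slack {d = d} s e∉H p = subst (λ t → suc t ≤ suc d) (sym (depth-dropped s e∉H)) (s≤s p)

  restrict-leaf-≤ : ∀ {H x F k d d′} → Restrict ends H (leaf x) F → k + d′ ≤ d → k + fSum d′ F ≤ d
  restrict-leaf-≤ {x = x} {k = k} {d} {d′} (leafIn _) h =
    subst (λ s → k + s ≤ d) (sym (fSum-leaf {m = m} d′ x)) h
  restrict-leaf-≤ {k = k} {d′ = d′} (leafOut _) h = ≤-trans (+-monoʳ-≤ k z≤n) h

  pairSumˡ pairSumʳ : ∀ {H₁ H₂ e l r d₁ d₂ F₁ F₂} →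
    NodeRestriction H₁ e l r d₁ F₁ → NodeRestriction H₂ e l r d₂ F₂ → ℕ
  pairSumˡ s₁ s₂ = fSum (depth s₁) (forestˡ s₁) + fSum (depth s₂) (forestˡ s₂)
  pairSumʳ s₁ s₂ = fSum (depth s₁) (forestʳ s₁) + fSum (depth s₂) (forestʳ s₂)

  node-pair-≤ : ∀ kˡ kʳ {H₁ H₂ e l r d₁ d₂ F₁ F₂ x y}
    (s₁ : NodeRestriction H₁ e l r d₁ F₁) (s₂ : NodeRestriction H₂ e l r d₂ F₂) →
    kˡ + pairSumˡ s₁ s₂ ≤ x → kʳ + pairSumʳ s₁ s₂ ≤ y →
    kˡ + kʳ + (fSum d₁ F₁ + fSum d₂ F₂) ≤ x + y
  node-pair-≤ kˡ kʳ s₁ s₂ =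
    interchange-≤ (fSum (depth s₁) (forestˡ s₁)) (fSum (depth s₁) (forestʳ s₁))
                  (fSum (depth s₂) (forestˡ s₂)) (fSum (depth s₂) (forestʳ s₂))
                  {kˡ = kˡ} {kʳ} (fSum-children s₁) (fSum-children s₂)

  module _ {H₁ H₂ : Sub n m} (disjoint : VertexDisjoint ends H₁ H₂) where

    -- T is rooted k levels deeper than both restrictions, and it has a leaf,
    -- which alone accounts for the k.
    restrict-pair-≤ : ∀ {T F₁ F₂} k d d₁ d₂ → Restrict ends H₁ T F₁ → Restrict ends H₂ T F₂ →
                      k + d₁ ≤ d → k + d₂ ≤ d → k + (fSum d₁ F₁ + fSum d₂ F₂) ≤ depthSum d T
    restrict-pair-≤ {leaf _} k d d₁ d₂ (leafIn v₁) (leafIn v₂) p q = ⊥-elim (disjoint v₁ v₂)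
    restrict-pair-≤ {leaf _} k d d₁ d₂ r₁ (leafOut _) p q =
      subst (λ s → k + s ≤ d) (sym (+-identityʳ _)) (restrict-leaf-≤ r₁ p)
    restrict-pair-≤ {leaf _} k d d₁ d₂ (leafOut _) r₂ p q = restrict-leaf-≤ r₂ q
    restrict-pair-≤ {node e l r} {F₁} {F₂} k d d₁ d₂ r₁ r₂ p q =
      node-pair-≤ 0 k s₁ s₂
        (restrict-pair-≤ 0 (suc d) _ _ (restrictˡ s₁) (restrictˡ s₂)
          (child-slack (depth≤ s₁) (≤-trans (m≤n+m d₁ k) p))
          (child-slack (depth≤ s₂) (≤-trans (m≤n+m d₂ k) q)))
        (restrict-pair-≤ k (suc d) _ _ (restrictʳ s₁) (restrictʳ s₂)
          (child-slack (depth≤ s₁) p) (child-slack (depth≤ s₂) q))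
      where
      s₁ : NodeRestriction H₁ e l r d₁ F₁
      s₁ = restrict-node d₁ r₁
      s₂ : NodeRestriction H₂ e l r d₂ F₂
      s₂ = restrict-node d₂ r₂

    restrict-pair-< : ∀ {e T F₁ F₂} d d₁ d₂ → Occurs e T → ¬ E H₁ e → ¬ E H₂ e →
                      Restrict ends H₁ T F₁ → Restrict ends H₂ T F₂ →
                      d₁ ≤ d → d₂ ≤ d → fSum d₁ F₁ + fSum d₂ F₂ < depthSum d T
    restrict-pair-< {e} {node f l r} {F₁} {F₂} d d₁ d₂ occ e∉H₁ e∉H₂ r₁ r₂ p q = at occ
      where
      s₁ : NodeRestriction H₁ f l r d₁ F₁
      s₁ = restrict-node d₁ r₁
      s₂ : NodeRestriction H₂ f l r d₂ F₂
      s₂ = restrict-node d₂ r₂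
      at : Occurs e (node f l r) → fSum d₁ F₁ + fSum d₂ F₂ < depthSum d (node f l r)
      at here = node-pair-≤ 0 1 s₁ s₂
        (restrict-pair-≤ 0 (suc d) _ _ (restrictˡ s₁) (restrictˡ s₂)
          (child-slack (depth≤ s₁) p) (child-slack (depth≤ s₂) q))
        (restrict-pair-≤ 1 (suc d) _ _ (restrictʳ s₁) (restrictʳ s₂)
          (dropped-child-slack s₁ e∉H₁ p) (dropped-child-slack s₂ e∉H₂ q))
      at (left occ) = node-pair-≤ 1 0 s₁ s₂
        (restrict-pair-< (suc d) _ _ occ e∉H₁ e∉H₂ (restrictˡ s₁) (restrictˡ s₂)
          (child-slack (depth≤ s₁) p) (child-slack (depth≤ s₂) q))
        (restrict-pair-≤ 0 (suc d) _ _ (restrictʳ s₁) (restrictʳ s₂)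
          (child-slack (depth≤ s₁) p) (child-slack (depth≤ s₂) q))
      at (right occ) = node-pair-≤ 0 1 s₁ s₂
        (restrict-pair-≤ 0 (suc d) _ _ (restrictˡ s₁) (restrictˡ s₂)
          (child-slack (depth≤ s₁) p) (child-slack (depth≤ s₂) q))
        (restrict-pair-< (suc d) _ _ occ e∉H₁ e∉H₂ (restrictʳ s₁) (restrictʳ s₂)
          (child-slack (depth≤ s₁) p) (child-slack (depth≤ s₂) q))

lemma2 : ∀ {n m} (ends : Fin m → Fin n × Fin n) →
         IsTree ends (Full ends) →
         (T : EPT n m) → IsEPT ends (Full ends) T →
         (e : Fin m) (u v : Fin n) → (ends e ≡ (u , v)) ⊎ (ends e ≡ (v , u)) →
         (Tu Tv : List (RTree n m)) →
         Restrict ends (Comp ends (_─_ ends (Full ends) e) u) T Tu →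
         Restrict ends (Comp ends (_─_ ends (Full ends) e) v) T Tv →
         EPTsumF Tu + EPTsumF Tv < EPTsum T
lemma2 ends (connected , acyclic) T ept e u v e-joins Tu Tv restrict-u restrict-v =
  restrict-pair-< ends disjoint 0 0 0 e-occurs
    (removed-edge-∉-comp ends) (removed-edge-∉-comp ends) restrict-u restrict-v z≤n z≤n
  where
  e-occurs : Occurs e T
  e-occurs = ept-edge-occurs ends ept connected (λ _ _ → tt , tt) tt
  disjoint : VertexDisjoint ends (Comp ends (_─_ ends (Full ends) e) u) (Comp ends (_─_ ends (Full ends) e) v)
  disjoint = comps-disjoint ends (bridge-separates ends acyclic tt e-joins)
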